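{- Let $T$ be a nonempty planar rooted tree with $n$ vertices. Define an integer $a_v$ for every vertex $v$ of $T$ by induction on the height: if $v$ is a leaf, $a_v=1$; otherwise $$a_v=\prod_{v'\to v}a_{v'}+\sum_{v'\to v}\Big(\prod_{v''\to v,\ v''<v'}a_{v''}\Big)\Big(\prod_{v''\to w\to v,\ v'\le w}a_{v''}\Big).$$ Then the number of bijections from the vertex set of $T$ onto $\{1,\dots,n\}$ for which the resulting ordered tree belongs to $\mathcal T$ equals $a_{r}$, where $r$ is the root of $T$.
   Context: In a planar rooted tree the children of each vertex are linearly ordered from left to right; $x\to y$ means $x$ is a child of $y$. For two children $v',v''$ of the same vertex, $v''<v'$ means $v''$ is to the left of $v'$, and $v'\le w$ means $w=v'$ or $w$ is to the right of $v'$. Empty products equal $1$. Thus the last product runs over the children $v''$ of those children $w$ of $v$ that are equal to or to the right of $v'$. An ordered tree of degree $n$ is a planar rooted tree with $n$ vertices and a bijection from its vertex set to $\{1,\dots,n\}$ (labels); $\bullet_1$ is the one-vertex tree. The product $T_1\cdots T_m$ of ordered trees is the forest (sequence $T_1,\dots,T_m$) in which the labels of $T_j$ are increased by $|T_1|+\dots+|T_{j-1}|$. For nonempty ordered trees $T_1,\dots,T_m$ ($m\ge1$) of total degree $n$: $B^-(T_1,\dots,T_m)$ is obtained from the forest $T_1\cdots T_m$ by adding a new root labelled $n+1$ whose children are the roots of $T_1,\dots,T_m$ in order; $B^+(T_1,\dots,T_m)$ is obtained from $T_1\cdots T_m$ by adding a new vertex labelled $n+1$ as the rightmost child of the root of $T_1$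 and making the roots of $T_2,\dots,T_m$ (in order) the children of this new vertex. $\mathcal T$ is the smallest set of ordered trees containing $\bullet_1$ and containing $B^-(T_1,\dots,T_m)$ and $B^+(T_1,\dots,T_m)$ for all $m\ge1$ and $T_1,\dots,T_m\in\mathcal T$. -}

module Defs where

open import Data.Nat using (ℕ; zero; suc; _+_; _*_)
open import Data.List using (List; []; _∷_; _++_; [_]; map; take; drop; length; upTo)
open import Data.Nat.ListAction using (sum; product)
open import Data.List.Relation.Unary.All using (All)

data PTree : Set where
  node : List PTree → PTree

mutual
  psize : PTree → ℕ
  psize (node cs) = suc (psizeF cs)

  psizeF : List PTree → ℕ
  psizeF []       = 0
  psizeF (c ∷ cs) = psize c + psizeF cs

-- The integers a_v.
-- aList cs   = the list of a_{v'} for the children v' in cs (in order)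
-- gList cs   = for each child w in cs, the product of a_{v''} over the
--              children v'' of w
-- For a vertex v with children cs = w_0,...,w_{k-1}:
--   a_v = ∏_j a_{w_j} + Σ_{j<k} (∏_{i<j} a_{w_i}) (∏_{i≥j} ∏_{v''→w_i} a_{v''})
-- and a_v = 1 for a leaf.

mutual
  a : PTree → ℕ
  a (node []) = 1
  a (node (c ∷ cs)) =
    product (aList (c ∷ cs))
    + sum (map (λ j → product (take j (aList (c ∷ cs)))
                      * product (drop j (gList (c ∷ cs))))
               (upTo (length (c ∷ cs))))

  aList : List PTree → List ℕ
  aList []       = []
  aList (c ∷ cs) = a c ∷ aList cs

  gList : List PTree → List ℕ
  gList []              = []
  gList (node gs ∷ cs) = product (aList gs) ∷ gList cs

-- Ordered trees: planar rooted trees with a label (natural number) at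
-- every vertex.  An ordered tree of degree n is one whose labels form a
-- bijection onto {1,...,n} (see `IsOrdered`).

data LTree : Set where
  lnode : ℕ → List LTree → LTree

mutual
  shape : LTree → PTree
  shape (lnode _ cs) = node (shapeF cs)

  shapeF : List LTree → List PTree
  shapeF []       = []
  shapeF (c ∷ cs) = shape c ∷ shapeF cs

mutual
  labels : LTree → List ℕ
  labels (lnode l cs) = l ∷ labelsF cs

  labelsF : List LTree → List ℕ
  labelsF []       = []
  labelsF (c ∷ cs) = labels c ++ labelsF cs

mutual
  lsize : LTree → ℕ
  lsize (lnode _ cs) = suc (lsizeF cs)

  lsizeF : List LTree → ℕ
  lsizeF []       = 0
  lsizeF (c ∷ cs) = lsize c + lsizeF cs

mutual
  shift : ℕ → LTree → LTree
  shift k (lnode l cs) = lnode (k + l) (shiftF k cs)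

  shiftF : ℕ → List LTree → List LTree
  shiftF k []       = []
  shiftF k (c ∷ cs) = shift k c ∷ shiftF k cs

-- product T_1 ⋯ T_m of ordered trees: the labels of T_j are increased by
-- |T_1| + ... + |T_{j-1}| (the accumulator k is that offset)
prodForest : ℕ → List LTree → List LTree
prodForest k []       = []
prodForest k (t ∷ ts) = shift k t ∷ prodForest (k + lsize t) ts

-- B⁻(T_1,...,T_m), with T_1 = t, (T_2,...,T_m) = ts  (so m ≥ 1)
Bminus : LTree → List LTree → LTree
Bminus t ts = lnode (suc (lsizeF (t ∷ ts))) (prodForest 0 (t ∷ ts))

-- B⁺(T_1,...,T_m), with T_1 = t, (T_2,...,T_m) = ts  (so m ≥ 1)
Bplus : LTree → List LTree → LTree
Bplus t ts with shift 0 t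
... | lnode l cs =
  lnode l (cs ++ [ lnode (suc (lsizeF (t ∷ ts))) (prodForest (lsize t) ts) ])

data InT : LTree → Set where
  dot    : InT (lnode 1 [])
  bminus : (t : LTree) (ts : List LTree) → All InT (t ∷ ts) → InT (Bminus t ts)
  bplus  : (t : LTree) (ts : List LTree) → All InT (t ∷ ts) → InT (Bplus t ts)

oneTo : ℕ → List ℕ
oneTo n = map suc (upTo n)

-- A tree of 𝒯 with n vertices is either B⁻ of the forest of its root's subtrees,
-- or B⁺(S, Q) where the vertex labelled n is the last child of the root and Q
-- is the forest of its subtrees; only in the first case is the root labelled n.
-- Both B⁻ and B⁺ are injective.  So if the root has children c₁,…,c_k and x_j
-- counts the 𝒯-trees shaped like the root with its first j children, then
-- x₀ = 1 and x_j = a_{c₁}⋯a_{c_j} + x_{j-1} g_{c_j}, where g_c is the product of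
-- the a's of the children of c; unrolling the recurrence gives x_k = a_r.
-- Running the decomposition as a program lists these trees without repetition,
-- and an induction over 𝒯 shows that their labels are exactly 1,…,n.
module Submission where

open import Defs
open import Data.Nat using (ℕ; zero; suc; _+_; _*_; _≤_; _<_; z≤n; s≤s)
open import Data.Nat.Properties
  using (+-assoc; +-suc; +-identityʳ; +-cancelˡ-≡; *-identityˡ; *-identityʳ; *-zeroʳ; *-assoc;
         *-distribˡ-+; ≤-trans; ≤-reflexive; <⇒≤; <-irrefl; m≤m+n)
open import Data.Nat.Solver using (module +-*-Solver)
open import Data.Nat.ListAction using (sum; product)
open import Data.Product using (Σ; _×_; _,_; ∃; ∃₂)
open import Data.Sum using (_⊎_; inj₁; inj₂)
open import Data.List
  using (List; []; _∷_; _++_; [_]; _∷ʳ_; map; length; upTo; take; drop;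
         cartesianProductWith; InitLast; initLast; _∷ʳ′_)
open import Data.List.Properties
  using (map-++; map-cong; map-∘; map-id; ++-assoc; ++-identityʳ; ++-conicalʳ;
         ∷-injective; ∷ʳ-injective; upTo-∷ʳ; length-++; length-map; map-applyUpTo)
open import Data.List.Membership.Propositional using (_∈_)
open import Data.List.Membership.Propositional.Properties
  using (∈-cartesianProductWith⁺; ∈-cartesianProductWith⁻; ∈-map⁺; ∈-map⁻;
         ∈-++⁺ˡ; ∈-++⁺ʳ; ∈-++⁻)
open import Data.List.Relation.Unary.Any using (here; there)
open import Data.List.Relation.Unary.All using (All; []; _∷_)
import Data.List.Relation.Unary.All.Properties as All
open import Data.List.Relation.Unary.AllPairs using ([]; _∷_)
open import Data.List.Relation.Unary.Unique.Propositional using (Unique)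
import Data.List.Relation.Unary.Unique.Propositional.Properties as Unique
open import Data.List.Relation.Binary.Permutation.Propositional
  using (_↭_; prep; ↭-refl; ↭-trans; ↭-reflexive)
import Data.List.Relation.Binary.Permutation.Propositional.Properties as ↭
open import Relation.Binary.PropositionalEquality
  using (_≡_; refl; sym; trans; cong; cong₂; subst; module ≡-Reasoning)
open import Relation.Nullary using (¬_)
open import Data.Empty using (⊥-elim)
open import Function using (_∘_)
open import Function.Bundles using (_⇔_; mk⇔; Equivalence)

open ≡-Reasoning

rootLabel : LTree → ℕ
rootLabel (lnode l _) = l

children : LTree → List LTree
children (lnode _ cs) = cs

shape-children : ∀ t → shape t ≡ node (shapeF (children t))
shape-children (lnode _ _) = refl

psize-shape : ∀ t → psize (shape t) ≡ lsize t
psizeF-shapeF : ∀ ts → psizeF (shapeF ts) ≡ lsizeF ts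
psize-shape (lnode _ cs) = cong suc (psizeF-shapeF cs)
psizeF-shapeF []       = refl
psizeF-shapeF (t ∷ ts) = cong₂ _+_ (psize-shape t) (psizeF-shapeF ts)

shapeF-++ : ∀ ts us → shapeF (ts ++ us) ≡ shapeF ts ++ shapeF us
shapeF-++ []       us = refl
shapeF-++ (t ∷ ts) us = cong (shape t ∷_) (shapeF-++ ts us)

lsizeF-++ : ∀ ts us → lsizeF (ts ++ us) ≡ lsizeF ts + lsizeF us
lsizeF-++ []       us = refl
lsizeF-++ (t ∷ ts) us = trans (cong (lsize t +_) (lsizeF-++ ts us)) (sym (+-assoc (lsize t) _ _))

labelsF-++ : ∀ ts us → labelsF (ts ++ us) ≡ labelsF ts ++ labelsF us
labelsF-++ []       us = refl
labelsF-++ (t ∷ ts) us = trans (cong (labels t ++_) (labelsF-++ ts us)) (sym (++-assoc (labels t) _ _))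

node-injective : ∀ {ps qs} → node ps ≡ node qs → ps ≡ qs
node-injective refl = refl

∷ʳ≢[] : ∀ {A : Set} (xs : List A) x → ¬ (xs ∷ʳ x ≡ [])
∷ʳ≢[] xs x eq with ++-conicalʳ xs [ x ] eq
... | ()

shape-shift : ∀ k t → shape (shift k t) ≡ shape t
shapeF-shiftF : ∀ k ts → shapeF (shiftF k ts) ≡ shapeF ts
shape-shift k (lnode _ cs) = cong node (shapeF-shiftF k cs)
shapeF-shiftF k []       = refl
shapeF-shiftF k (t ∷ ts) = cong₂ _∷_ (shape-shift k t) (shapeF-shiftF k ts)

lsize-shift : ∀ k t → lsize (shift k t) ≡ lsize t
lsizeF-shiftF : ∀ k ts → lsizeF (shiftF k ts) ≡ lsizeF ts
lsize-shift k (lnode _ cs) = cong suc (lsizeF-shiftF k cs)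
lsizeF-shiftF k []       = refl
lsizeF-shiftF k (t ∷ ts) = cong₂ _+_ (lsize-shift k t) (lsizeF-shiftF k ts)

labels-shift : ∀ k t → labels (shift k t) ≡ map (k +_) (labels t)
labelsF-shiftF : ∀ k ts → labelsF (shiftF k ts) ≡ map (k +_) (labelsF ts)
labels-shift k (lnode l cs) = cong (k + l ∷_) (labelsF-shiftF k cs)
labelsF-shiftF k []       = refl
labelsF-shiftF k (t ∷ ts) =
  trans (cong₂ _++_ (labels-shift k t) (labelsF-shiftF k ts)) (sym (map-++ (k +_) (labels t) (labelsF ts)))

shift-identity : ∀ t → shift 0 t ≡ t
shiftF-identity : ∀ ts → shiftF 0 ts ≡ ts
shift-identity (lnode l cs) = cong (lnode l) (shiftF-identity cs)
shiftF-identity []       = refl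
shiftF-identity (t ∷ ts) = cong₂ _∷_ (shift-identity t) (shiftF-identity ts)

shift-injective : ∀ k {t u} → shift k t ≡ shift k u → t ≡ u
shiftF-injective : ∀ k {ts us} → shiftF k ts ≡ shiftF k us → ts ≡ us
shift-injective k {lnode l cs} {lnode m ds} eq =
  cong₂ lnode (+-cancelˡ-≡ k l m (cong rootLabel eq)) (shiftF-injective k (cong children eq))
shiftF-injective k {[]}     {[]}     eq = refl
shiftF-injective k {t ∷ ts} {u ∷ us} eq with ∷-injective eq
... | eq₁ , eq₂ = cong₂ _∷_ (shift-injective k eq₁) (shiftF-injective k eq₂)

shapeF-prodForest : ∀ k ts → shapeF (prodForest k ts) ≡ shapeF ts
shapeF-prodForest k []       = refl
shapeF-prodForest k (t ∷ ts) = cong₂ _∷_ (shape-shift k t) (shapeF-prodForest (k + lsize t) ts)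

lsizeF-prodForest : ∀ k ts → lsizeF (prodForest k ts) ≡ lsizeF ts
lsizeF-prodForest k []       = refl
lsizeF-prodForest k (t ∷ ts) = cong₂ _+_ (lsize-shift k t) (lsizeF-prodForest (k + lsize t) ts)

prodForest-injective : ∀ k ts us → prodForest k ts ≡ prodForest k us → ts ≡ us
prodForest-injective k []       []       eq = refl
prodForest-injective k (t ∷ ts) (u ∷ us) eq with ∷-injective eq
... | eq₁ , eq₂ with shift-injective k eq₁
... | refl = cong (t ∷_) (prodForest-injective (k + lsize t) ts us eq₂)

oneTo-suc : ∀ n → oneTo (suc n) ≡ oneTo n ∷ʳ suc n
oneTo-suc n = trans (cong (map suc) (sym (upTo-∷ʳ n))) (map-++ suc (upTo n) [ n ])

oneTo-+ : ∀ m n → oneTo (m + n) ≡ oneTo m ++ map (m +_) (oneTo n)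
oneTo-+ m zero = trans (cong oneTo (+-identityʳ m)) (sym (++-identityʳ _))
oneTo-+ m (suc n) = begin
  oneTo (m + suc n)                                      ≡⟨ cong oneTo (+-suc m n) ⟩
  oneTo (suc (m + n))                                    ≡⟨ oneTo-suc (m + n) ⟩
  oneTo (m + n) ∷ʳ suc (m + n)                           ≡⟨ cong (_∷ʳ suc (m + n)) (oneTo-+ m n) ⟩
  (oneTo m ++ map (m +_) (oneTo n)) ∷ʳ suc (m + n)       ≡⟨ ++-assoc (oneTo m) _ _ ⟩
  oneTo m ++ (map (m +_) (oneTo n) ∷ʳ suc (m + n))
    ≡⟨ cong (λ z → oneTo m ++ (map (m +_) (oneTo n) ∷ʳ z)) (sym (+-suc m n)) ⟩
  oneTo m ++ (map (m +_) (oneTo n) ∷ʳ (m + suc n))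
    ≡⟨ cong (oneTo m ++_) (sym (map-++ (m +_) (oneTo n) _)) ⟩
  oneTo m ++ map (m +_) (oneTo n ∷ʳ suc n)
    ≡⟨ cong (λ z → oneTo m ++ map (m +_) z) (sym (oneTo-suc n)) ⟩
  oneTo m ++ map (m +_) (oneTo (suc n))                  ∎

map-+-+ : ∀ k m xs → map (k +_) (map (m +_) xs) ≡ map ((k + m) +_) xs
map-+-+ k m xs = trans (sym (map-∘ xs)) (map-cong (λ x → sym (+-assoc k m x)) xs)

WellLabelled : LTree → Set
WellLabelled t = labels t ↭ oneTo (lsize t)

labelsF-prodForest : ∀ k ts → All WellLabelled ts →
  labelsF (prodForest k ts) ↭ map (k +_) (oneTo (lsizeF ts))
labelsF-prodForest k []       []         = ↭-refl
labelsF-prodForest k (t ∷ ts) (wt ∷ wts) =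
  ↭-trans (↭.++⁺ (↭-trans (↭-reflexive (labels-shift k t)) (↭.map⁺ (k +_) wt))
                 (labelsF-prodForest (k + lsize t) ts wts))
          (↭-reflexive intervals)
  where
  intervals : map (k +_) (oneTo (lsize t)) ++ map ((k + lsize t) +_) (oneTo (lsizeF ts))
              ≡ map (k +_) (oneTo (lsize t + lsizeF ts))
  intervals = begin
    map (k +_) (oneTo (lsize t)) ++ map ((k + lsize t) +_) (oneTo (lsizeF ts))
      ≡⟨ cong (map (k +_) (oneTo (lsize t)) ++_) (sym (map-+-+ k (lsize t) _)) ⟩
    map (k +_) (oneTo (lsize t)) ++ map (k +_) (map (lsize t +_) (oneTo (lsizeF ts)))
      ≡⟨ sym (map-++ (k +_) (oneTo (lsize t)) _) ⟩
    map (k +_) (oneTo (lsize t) ++ map (lsize t +_) (oneTo (lsizeF ts)))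
      ≡⟨ cong (map (k +_)) (sym (oneTo-+ (lsize t) (lsizeF ts))) ⟩
    map (k +_) (oneTo (lsize t + lsizeF ts)) ∎

newVertex : LTree → List LTree → LTree
newVertex t ts = lnode (suc (lsizeF (t ∷ ts))) (prodForest (lsize t) ts)

Bplus-unfold : ∀ t ts → Bplus t ts ≡ lnode (rootLabel t) (children t ∷ʳ newVertex t ts)
Bplus-unfold t@(lnode l cs) ts = cong (λ ds → lnode l (ds ∷ʳ newVertex t ts)) (shiftF-identity cs)

rootLabel-Bplus : ∀ t ts → rootLabel (Bplus t ts) ≡ rootLabel t
rootLabel-Bplus t ts = cong rootLabel (Bplus-unfold t ts)

shape-Bplus : ∀ t ts → shape (Bplus t ts) ≡ node (shapeF (children t) ∷ʳ node (shapeF ts))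
shape-Bplus t ts = begin
  shape (Bplus t ts)                                                 ≡⟨ cong shape (Bplus-unfold t ts) ⟩
  node (shapeF (children t ∷ʳ newVertex t ts))                       ≡⟨ cong node (shapeF-++ (children t) _) ⟩
  node (shapeF (children t) ∷ʳ node (shapeF (prodForest (lsize t) ts)))
    ≡⟨ cong (λ ps → node (shapeF (children t) ∷ʳ node ps)) (shapeF-prodForest (lsize t) ts) ⟩
  node (shapeF (children t) ∷ʳ node (shapeF ts))                     ∎

lsize-Bplus : ∀ t ts → lsize (Bplus t ts) ≡ suc (lsizeF (t ∷ ts))
lsize-Bplus t@(lnode l cs) ts = begin
  lsize (Bplus t ts)                                      ≡⟨ cong lsize (Bplus-unfold t ts) ⟩
  suc (lsizeF (cs ∷ʳ newVertex t ts))                     ≡⟨ cong suc (lsizeF-++ cs _) ⟩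
  suc (lsizeF cs + (suc (lsizeF (prodForest (lsize t) ts)) + 0))
    ≡⟨ cong (λ n → suc (lsizeF cs + n)) (+-identityʳ _) ⟩
  suc (lsizeF cs + suc (lsizeF (prodForest (lsize t) ts)))
    ≡⟨ cong (λ n → suc (lsizeF cs + suc n)) (lsizeF-prodForest (lsize t) ts) ⟩
  suc (lsizeF cs + suc (lsizeF ts))                       ≡⟨ cong suc (+-suc (lsizeF cs) (lsizeF ts)) ⟩
  suc (lsizeF (t ∷ ts))                                   ∎

labels-Bplus↭Bminus : ∀ t ts → labels (Bplus t ts) ↭ labels (Bminus t ts)
labels-Bplus↭Bminus t@(lnode l cs) ts =
  ↭-trans (↭-reflexive unfold) (↭-trans (↭.shift (suc N) (labels t) rest) (↭-reflexive refold))
  where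
  N = lsizeF (t ∷ ts)
  rest = labelsF (prodForest (lsize t) ts)
  unfold : labels (Bplus t ts) ≡ labels t ++ [ suc N ] ++ rest
  unfold = trans (cong labels (Bplus-unfold t ts))
                 (cong (l ∷_) (trans (labelsF-++ cs _) (cong (labelsF cs ++_) (++-identityʳ _))))
  refold : suc N ∷ labels t ++ rest ≡ labels (Bminus t ts)
  refold = cong (λ u → suc N ∷ labels u ++ rest) (sym (shift-identity t))

Bplus-injective : ∀ {s s′ q q′} → Bplus s q ≡ Bplus s′ q′ → s ≡ s′ × q ≡ q′
Bplus-injective {s@(lnode l cs)} {lnode l′ cs′} {q} {q′} eq
  with trans (sym (Bplus-unfold s q)) (trans eq (Bplus-unfold _ q′))
... | eq′ with cong rootLabel eq′ | ∷ʳ-injective cs cs′ (cong children eq′)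
... | refl | refl , eqᵥ = refl , prodForest-injective (lsize s) q q′ (cong children eqᵥ)

shape-Bminus : ∀ t ts → shape (Bminus t ts) ≡ node (shapeF (t ∷ ts))
shape-Bminus t ts = cong node (shapeF-prodForest 0 (t ∷ ts))

lsize-Bminus : ∀ t ts → lsize (Bminus t ts) ≡ suc (lsizeF (t ∷ ts))
lsize-Bminus t ts = cong suc (lsizeF-prodForest 0 (t ∷ ts))

Bminus-injective : ∀ {t ts u us} → Bminus t ts ≡ Bminus u us → t ∷ ts ≡ u ∷ us
Bminus-injective eq = prodForest-injective 0 _ _ (cong children eq)

Bminus-wellLabelled : ∀ t ts → All WellLabelled (t ∷ ts) → WellLabelled (Bminus t ts)
Bminus-wellLabelled t ts wts =
  ↭-trans (prep (suc N) (labelsF-prodForest 0 (t ∷ ts) wts))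
    (↭-trans (↭-reflexive (cong (suc N ∷_) (map-id (oneTo N))))
      (↭-trans (↭.∷↭∷ʳ (suc N) (oneTo N))
        (↭-reflexive (trans (sym (oneTo-suc N)) (cong oneTo (sym (lsize-Bminus t ts)))))))
  where N = lsizeF (t ∷ ts)

InT-wellLabelled : ∀ {t} → InT t → WellLabelled t
All-InT-wellLabelled : ∀ {ts} → All InT ts → All WellLabelled ts
InT-wellLabelled dot = ↭-refl
InT-wellLabelled (bminus t ts ps) = Bminus-wellLabelled t ts (All-InT-wellLabelled ps)
InT-wellLabelled (bplus t ts ps) =
  ↭-trans (labels-Bplus↭Bminus t ts)
    (subst (λ n → labels (Bminus t ts) ↭ oneTo n) (trans (lsize-Bminus t ts) (sym (lsize-Bplus t ts)))
      (Bminus-wellLabelled t ts (All-InT-wellLabelled ps)))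
All-InT-wellLabelled []       = []
All-InT-wellLabelled (p ∷ ps) = InT-wellLabelled p ∷ All-InT-wellLabelled ps

rootLabel-Bplus< : ∀ t ts → rootLabel t ≤ lsize t → rootLabel (Bplus t ts) < lsize (Bplus t ts)
rootLabel-Bplus< t ts r≤n rewrite rootLabel-Bplus t ts | lsize-Bplus t ts =
  s≤s (≤-trans r≤n (m≤m+n (lsize t) (lsizeF ts)))

InT-rootLabel≤lsize : ∀ {t} → InT t → rootLabel t ≤ lsize t
InT-rootLabel≤lsize dot                 = s≤s z≤n
InT-rootLabel≤lsize (bminus t ts _)      = ≤-reflexive (sym (lsize-Bminus t ts))
InT-rootLabel≤lsize (bplus t ts (p ∷ _)) = <⇒≤ (rootLabel-Bplus< t ts (InT-rootLabel≤lsize p))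

record Enumerates {A : Set} (P : A → Set) (xs : List A) : Set where
  constructor enumerates
  field
    unique  : Unique xs
    members : ∀ x → x ∈ xs ⇔ P x

module _ {A : Set} where

  Enumerates-[_] : (x : A) → Enumerates (_≡ x) [ x ]
  Enumerates-[ x ] = enumerates ([] ∷ []) (λ y → mk⇔ (λ { (here eq) → eq ; (there ()) }) here)

  Enumerates-⇔ : ∀ {P Q : A → Set} {xs} → (∀ x → P x ⇔ Q x) → Enumerates P xs → Enumerates Q xs
  Enumerates-⇔ P⇔Q (enumerates u m) =
    enumerates u (λ x → mk⇔ (Equivalence.to (P⇔Q x) ∘ Equivalence.to (m x))
                            (Equivalence.from (m x) ∘ Equivalence.from (P⇔Q x)))

  Enumerates-++ : ∀ {P Q : A → Set} {xs ys} → (∀ {x} → ¬ (P x × Q x)) →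
    Enumerates P xs → Enumerates Q ys → Enumerates (λ x → P x ⊎ Q x) (xs ++ ys)
  Enumerates-++ {xs = xs} P∩Q≡∅ (enumerates u m) (enumerates v n) =
    enumerates (Unique.++⁺ u v λ (x∈xs , x∈ys) → P∩Q≡∅ (Equivalence.to (m _) x∈xs , Equivalence.to (n _) x∈ys))
               (λ x → mk⇔ (to x) from)
    where
    to : ∀ x → x ∈ xs ++ _ → _
    to x x∈ with ∈-++⁻ xs x∈
    ... | inj₁ x∈xs = inj₁ (Equivalence.to (m x) x∈xs)
    ... | inj₂ x∈ys = inj₂ (Equivalence.to (n x) x∈ys)
    from : ∀ {x} → _ → x ∈ xs ++ _
    from (inj₁ px) = ∈-++⁺ˡ (Equivalence.from (m _) px)
    from (inj₂ qx) = ∈-++⁺ʳ xs (Equivalence.from (n _) qx)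

module _ {A B : Set} {P : A → Set} (f : A → B) (f-injective : ∀ {x y} → f x ≡ f y → x ≡ y) where

  Enumerates-map : ∀ {xs} → Enumerates P xs → Enumerates (λ y → ∃ λ x → P x × y ≡ f x) (map f xs)
  Enumerates-map {xs} (enumerates u m) = enumerates (Unique.map⁺ f-injective u) (λ y → mk⇔ to from)
    where
    to : ∀ {y} → y ∈ map f xs → ∃ λ x → P x × y ≡ f x
    to y∈ with ∈-map⁻ f y∈
    ... | x , x∈xs , refl = x , Equivalence.to (m x) x∈xs , refl
    from : ∀ {y} → (∃ λ x → P x × y ≡ f x) → y ∈ map f xs
    from (x , px , refl) = ∈-map⁺ f (Equivalence.from (m x) px)

module _ {A B C : Set} {P : A → Set} {Q : B → Set} (f : A → B → C)
         (f-injective : ∀ {w x y z} → f w y ≡ f x z → w ≡ x × y ≡ z) where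

  Enumerates-cartesianProductWith : ∀ {xs ys} → Enumerates P xs → Enumerates Q ys →
    Enumerates (λ z → ∃₂ λ x y → P x × Q y × z ≡ f x y) (cartesianProductWith f xs ys)
  Enumerates-cartesianProductWith {xs} {ys} (enumerates u m) (enumerates v n) =
    enumerates (Unique.cartesianProductWith⁺ f f-injective u v) (λ z → mk⇔ to from)
    where
    to : ∀ {z} → z ∈ cartesianProductWith f xs ys → ∃₂ λ x y → P x × Q y × z ≡ f x y
    to z∈ with ∈-cartesianProductWith⁻ f xs ys z∈
    ... | x , y , x∈xs , y∈ys , refl = x , y , Equivalence.to (m x) x∈xs , Equivalence.to (n y) y∈ys , refl
    from : ∀ {z} → (∃₂ λ x y → P x × Q y × z ≡ f x y) → z ∈ cartesianProductWith f xs ys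
    from (x , y , px , qy , refl) = ∈-cartesianProductWith⁺ f (Equivalence.from (m x) px) (Equivalence.from (n y) qy)

length-cartesianProductWith : ∀ {A B C : Set} (f : A → B → C) xs ys →
  length (cartesianProductWith f xs ys) ≡ length xs * length ys
length-cartesianProductWith f []       ys = refl
length-cartesianProductWith f (x ∷ xs) ys =
  trans (length-++ (map (f x) ys)) (cong₂ _+_ (length-map (f x) ys) (length-cartesianProductWith f xs ys))

TreeOfShape : PTree → LTree → Set
TreeOfShape T t = shape t ≡ T × InT t

ForestOfShape : List PTree → List LTree → Set
ForestOfShape ps ts = shapeF ts ≡ ps × All InT ts

-- B⁻ needs a nonempty forest; the junk value on [] is chosen with root label = size.
BminusForest : List LTree → LTree
BminusForest []       = lnode 1 []
BminusForest (t ∷ ts) = Bminus t ts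

BminusForest-injective : ∀ {ts us} → BminusForest ts ≡ BminusForest us → ts ≡ us
BminusForest-injective {[]}     {[]}     eq = refl
BminusForest-injective {t ∷ ts} {u ∷ us} eq = Bminus-injective eq

rootLabel-BminusForest : ∀ ts → rootLabel (BminusForest ts) ≡ lsize (BminusForest ts)
rootLabel-BminusForest []       = refl
rootLabel-BminusForest (t ∷ ts) = sym (lsize-Bminus t ts)

forestOfShape-[] : ∀ ts → ts ≡ [] ⇔ ForestOfShape [] ts
forestOfShape-[] ts = mk⇔ (λ { refl → refl , [] }) (λ { (sh , _) → shapeF≡[] ts sh })
  where
  shapeF≡[] : ∀ ts → shapeF ts ≡ [] → ts ≡ []
  shapeF≡[] [] _ = refl

forestOfShape-∷ : ∀ p ps ts →
  (∃₂ λ u us → TreeOfShape p u × ForestOfShape ps us × ts ≡ u ∷ us) ⇔ ForestOfShape (p ∷ ps) ts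
forestOfShape-∷ p ps ts = mk⇔ to from
  where
  to : _ → ForestOfShape (p ∷ ps) ts
  to (u , us , (refl , iu) , (refl , ius) , refl) = refl , iu ∷ ius
  from : ForestOfShape (p ∷ ps) ts → _
  from (sh , iu ∷ ius) with ∷-injective sh
  ... | shu , shus = _ , _ , (shu , iu) , (shus , ius) , refl

forestOfShape-∷ʳ : ∀ ps p ts →
  (∃₂ λ us u → ForestOfShape ps us × TreeOfShape p u × ts ≡ us ∷ʳ u) ⇔ ForestOfShape (ps ∷ʳ p) ts
forestOfShape-∷ʳ ps p ts = mk⇔ to (from (initLast ts))
  where
  to : _ → ForestOfShape (ps ∷ʳ p) ts
  to (us , u , (refl , ius) , (refl , iu) , refl) = shapeF-++ us [ u ] , All.++⁺ ius (iu ∷ [])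
  from : InitLast ts → ForestOfShape (ps ∷ʳ p) ts → _
  from [] (sh , _) = ⊥-elim (∷ʳ≢[] ps p (sym sh))
  from (us ∷ʳ′ u) (sh , i) with ∷ʳ-injective (shapeF us) ps (trans (sym (shapeF-++ us [ u ])) sh)
  ... | shus , shu = us , u , (shus , All.++⁻ˡ us i) , (shu , lastInT (All.++⁻ʳ us i)) , refl
    where
    lastInT : All InT [ u ] → InT u
    lastInT (iu ∷ []) = iu

treeOfShape-leaf : ∀ t → t ≡ lnode 1 [] ⇔ TreeOfShape (node []) t
treeOfShape-leaf t = mk⇔ (λ { refl → refl , dot }) (λ { (sh , it) → from sh it })
  where
  from : ∀ {t} → shape t ≡ node [] → InT t → t ≡ lnode 1 []
  from _  dot = refl
  from sh (bplus u us _) = ⊥-elim (∷ʳ≢[] _ _ (node-injective (trans (sym (shape-Bplus u us)) sh)))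

BminusForest≢Bplus : ∀ us {s} q → InT s → ¬ (BminusForest us ≡ Bplus s q)
BminusForest≢Bplus us {s} q is eq =
  <-irrefl (rootLabel-BminusForest us)
           (subst (λ t → rootLabel t < lsize t) (sym eq) (rootLabel-Bplus< s q (InT-rootLabel≤lsize is)))

BminusImage : List PTree → LTree → Set
BminusImage ps t = ∃ λ us → ForestOfShape ps us × t ≡ BminusForest us

BplusImage : List PTree → List PTree → LTree → Set
BplusImage ps gs t = ∃₂ λ s q → TreeOfShape (node ps) s × ForestOfShape gs q × t ≡ Bplus s q

BminusImage-BplusImage-disjoint : ∀ {qs ps gs t} → ¬ (BminusImage qs t × BplusImage ps gs t)
BminusImage-BplusImage-disjoint ((us , _ , refl) , (_ , q , (_ , is) , _ , eq)) = BminusForest≢Bplus us q is eq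

treeOfShape-∷ʳ : ∀ ps gs t →
  (BminusImage (ps ∷ʳ node gs) t ⊎ BplusImage ps gs t) ⇔ TreeOfShape (node (ps ∷ʳ node gs)) t
treeOfShape-∷ʳ ps gs t = mk⇔ to (λ (sh , it) → from sh it)
  where
  to : BminusImage (ps ∷ʳ node gs) t ⊎ BplusImage ps gs t → TreeOfShape (node (ps ∷ʳ node gs)) t
  to (inj₁ ([] , (sh , _) , _)) = ⊥-elim (∷ʳ≢[] ps (node gs) (sym sh))
  to (inj₁ (u ∷ us , (sh , ius) , refl)) = trans (shape-Bminus u us) (cong node sh) , bminus u us ius
  to (inj₂ (s , q , (shs , is) , (shq , iq) , refl)) =
    trans (shape-Bplus s q) (cong node (cong₂ _∷ʳ_ (node-injective (trans (sym (shape-children s)) shs))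
                                                    (cong node shq)))
    , bplus s q (is ∷ iq)
  from : ∀ {t} → shape t ≡ node (ps ∷ʳ node gs) → InT t →
         BminusImage (ps ∷ʳ node gs) t ⊎ BplusImage ps gs t
  from sh dot = ⊥-elim (∷ʳ≢[] ps (node gs) (sym (node-injective sh)))
  from sh (bminus u us ius) = inj₁ (u ∷ us , (node-injective (trans (sym (shape-Bminus u us)) sh) , ius) , refl)
  from sh (bplus s q (is ∷ iq))
    with ∷ʳ-injective _ ps (node-injective (trans (sym (shape-Bplus s q)) sh))
  ... | shs , shq = inj₂ (s , q , (trans (shape-children s) (cong node shs) , is) , (node-injective shq , iq) , refl)

snocForests : List (List LTree) → List LTree → List (List LTree)
snocForests F ts = cartesianProductWith _∷ʳ_ F ts

graftTrees : List (List LTree) → List LTree → List (List LTree) → List LTree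
graftTrees F S Q = map BminusForest F ++ cartesianProductWith Bplus S Q

snocForests-enumerates : ∀ {ps c F ts} → Enumerates (ForestOfShape ps) F → Enumerates (TreeOfShape c) ts →
  Enumerates (ForestOfShape (ps ∷ʳ c)) (snocForests F ts)
snocForests-enumerates {ps} {c} eF eT =
  Enumerates-⇔ (forestOfShape-∷ʳ ps c)
    (Enumerates-cartesianProductWith _∷ʳ_ (λ {w} {x} → ∷ʳ-injective w x) eF eT)

graftTrees-enumerates : ∀ {ps gs F S Q} → Enumerates (ForestOfShape (ps ∷ʳ node gs)) F →
  Enumerates (TreeOfShape (node ps)) S → Enumerates (ForestOfShape gs) Q →
  Enumerates (TreeOfShape (node (ps ∷ʳ node gs))) (graftTrees F S Q)
graftTrees-enumerates {ps} {gs} eF eS eQ =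
  Enumerates-⇔ (treeOfShape-∷ʳ ps gs)
    (Enumerates-++ BminusImage-BplusImage-disjoint
      (Enumerates-map BminusForest BminusForest-injective eF)
      (Enumerates-cartesianProductWith Bplus Bplus-injective eS eQ))

treesOfShape : PTree → List LTree
forestsOfShape : List PTree → List (List LTree)
extendTrees : List (List LTree) → List LTree → List PTree → List LTree

treesOfShape (node cs) = extendTrees [ [] ] [ lnode 1 [] ] cs

forestsOfShape []       = [ [] ]
forestsOfShape (p ∷ ps) = cartesianProductWith _∷_ (treesOfShape p) (forestsOfShape ps)

extendTrees F S []             = S
extendTrees F S (node gs ∷ cs) =
  let F′ = snocForests F (treesOfShape (node gs))
  in extendTrees F′ (graftTrees F′ S (forestsOfShape gs)) cs

treesOfShape-enumerates : ∀ T → Enumerates (TreeOfShape T) (treesOfShape T)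
forestsOfShape-enumerates : ∀ ps → Enumerates (ForestOfShape ps) (forestsOfShape ps)
extendTrees-enumerates : ∀ ps cs {F S} →
  Enumerates (ForestOfShape ps) F → Enumerates (TreeOfShape (node ps)) S →
  Enumerates (TreeOfShape (node (ps ++ cs))) (extendTrees F S cs)

treesOfShape-enumerates (node cs) =
  extendTrees-enumerates [] cs (Enumerates-⇔ forestOfShape-[] Enumerates-[ [] ])
                               (Enumerates-⇔ treeOfShape-leaf Enumerates-[ lnode 1 [] ])

forestsOfShape-enumerates []       = Enumerates-⇔ forestOfShape-[] Enumerates-[ [] ]
forestsOfShape-enumerates (p ∷ ps) =
  Enumerates-⇔ (forestOfShape-∷ p ps)
    (Enumerates-cartesianProductWith _∷_ ∷-injective (treesOfShape-enumerates p) (forestsOfShape-enumerates ps))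

extendTrees-enumerates ps [] _ eS =
  subst (λ qs → Enumerates (TreeOfShape (node qs)) _) (sym (++-identityʳ ps)) eS
extendTrees-enumerates ps (node gs ∷ cs) eF eS =
  let eF′ = snocForests-enumerates eF (treesOfShape-enumerates (node gs))
  in subst (λ qs → Enumerates (TreeOfShape (node qs)) _) (++-assoc ps [ node gs ] cs)
       (extendTrees-enumerates (ps ∷ʳ node gs) cs eF′ (graftTrees-enumerates eF′ eS (forestsOfShape-enumerates gs)))

prefixSuffixSum : List PTree → ℕ
prefixSuffixSum cs =
  sum (map (λ j → product (take j (aList cs)) * product (drop j (gList cs))) (upTo (length cs)))

a-unfold : ∀ cs → a (node cs) ≡ product (aList cs) + prefixSuffixSum cs
a-unfold []      = refl
a-unfold (_ ∷ _) = refl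

sum-map-upTo-suc : ∀ (f : ℕ → ℕ) n → sum (map f (upTo (suc n))) ≡ f 0 + sum (map (f ∘ suc) (upTo n))
sum-map-upTo-suc f n =
  cong (λ xs → f 0 + sum xs) (trans (map-applyUpTo suc f n) (sym (map-applyUpTo (λ x → x) (f ∘ suc) n)))

sum-map-*ˡ : ∀ x (f : ℕ → ℕ) ns → sum (map (λ n → x * f n) ns) ≡ x * sum (map f ns)
sum-map-*ˡ x f []       = sym (*-zeroʳ x)
sum-map-*ˡ x f (n ∷ ns) = trans (cong (x * f n +_) (sum-map-*ˡ x f ns)) (sym (*-distribˡ-+ x (f n) _))

prefixSuffixSum-∷ : ∀ gs cs →
  prefixSuffixSum (node gs ∷ cs) ≡ product (gList (node gs ∷ cs)) + a (node gs) * prefixSuffixSum cs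
prefixSuffixSum-∷ gs cs = begin
  prefixSuffixSum (node gs ∷ cs)
    ≡⟨ sum-map-upTo-suc _ (length cs) ⟩
  1 * product (gList (node gs ∷ cs))
    + sum (map (λ j → (x * product (take j as)) * product (drop j hs)) (upTo (length cs)))
    ≡⟨ cong₂ _+_ (*-identityˡ _) (cong sum (map-cong (λ j → *-assoc x _ _) (upTo (length cs)))) ⟩
  product (gList (node gs ∷ cs))
    + sum (map (λ j → x * (product (take j as) * product (drop j hs))) (upTo (length cs)))
    ≡⟨ cong (product (gList (node gs ∷ cs)) +_) (sum-map-*ˡ x _ (upTo (length cs))) ⟩
  product (gList (node gs ∷ cs)) + x * prefixSuffixSum cs ∎
  where
  x = a (node gs)
  as = aList cs
  hs = gList cs

-- Σ_{1 ≤ j ≤ k} a_{c_1}⋯a_{c_j} · g_{c_{j+1}}⋯g_{c_k}, whereas prefixSuffixSum runs over 0 ≤ j < k.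
prefixSuffixSum⁺ : List PTree → ℕ
prefixSuffixSum⁺ []       = 0
prefixSuffixSum⁺ (c ∷ cs) = a c * (prefixSuffixSum⁺ cs + product (gList cs))

a-node : ∀ cs → a (node cs) ≡ prefixSuffixSum⁺ cs + product (gList cs)
a-node []                = refl
a-node (c@(node gs) ∷ cs) = begin
  a (node (c ∷ cs))                                    ≡⟨ cong (a c * P +_) (prefixSuffixSum-∷ gs cs) ⟩
  a c * P + (g * G + a c * prefixSuffixSum cs)         ≡⟨ rearrange (a c) P g G (prefixSuffixSum cs) ⟩
  a c * (P + prefixSuffixSum cs) + g * G
    ≡⟨ cong (λ n → a c * n + g * G) (trans (sym (a-unfold cs)) (a-node cs)) ⟩
  a c * (prefixSuffixSum⁺ cs + G) + g * G              ∎
  where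
  P = product (aList cs)
  G = product (gList cs)
  g = product (aList gs)
  rearrange : ∀ x p y z s → x * p + (y * z + x * s) ≡ x * (p + s) + y * z
  rearrange = solve 5 (λ x p y z s → x :* p :+ (y :* z :+ x :* s) := x :* (p :+ s) :+ y :* z) refl
    where open +-*-Solver

length-graftTrees : ∀ F S Q → length (graftTrees F S Q) ≡ length F + length S * length Q
length-graftTrees F S Q =
  trans (length-++ (map BminusForest F))
        (cong₂ _+_ (length-map BminusForest F) (length-cartesianProductWith Bplus S Q))

length-treesOfShape : ∀ T → length (treesOfShape T) ≡ a T
length-forestsOfShape : ∀ ps → length (forestsOfShape ps) ≡ product (aList ps)
length-extendTrees : ∀ F S cs →
  length (extendTrees F S cs) ≡ length F * prefixSuffixSum⁺ cs + length S * product (gList cs)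

length-treesOfShape (node cs) =
  trans (length-extendTrees [ [] ] [ lnode 1 [] ] cs)
        (trans (cong₂ _+_ (*-identityˡ (prefixSuffixSum⁺ cs)) (*-identityˡ (product (gList cs))))
               (sym (a-node cs)))

length-forestsOfShape []       = refl
length-forestsOfShape (p ∷ ps) =
  trans (length-cartesianProductWith _∷_ (treesOfShape p) (forestsOfShape ps))
        (cong₂ _*_ (length-treesOfShape p) (length-forestsOfShape ps))

length-extendTrees F S [] = sym (cong₂ _+_ (*-zeroʳ (length F)) (*-identityʳ (length S)))
length-extendTrees F S (node gs ∷ cs) = begin
  length (extendTrees F′ (graftTrees F′ S Q) cs)
    ≡⟨ length-extendTrees F′ (graftTrees F′ S Q) cs ⟩
  length F′ * X + length (graftTrees F′ S Q) * G
    ≡⟨ cong (λ n → length F′ * X + n * G) (length-graftTrees F′ S Q) ⟩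
  length F′ * X + (length F′ + length S * length Q) * G
    ≡⟨ cong (λ n → length F′ * X + (length F′ + length S * n) * G) (length-forestsOfShape gs) ⟩
  length F′ * X + (length F′ + length S * g) * G
    ≡⟨ cong (λ n → n * X + (n + length S * g) * G) (length-cartesianProductWith _∷ʳ_ F _) ⟩
  length F * length Tc * X + (length F * length Tc + length S * g) * G
    ≡⟨ cong (λ n → length F * n * X + (length F * n + length S * g) * G) (length-treesOfShape (node gs)) ⟩
  length F * a (node gs) * X + (length F * a (node gs) + length S * g) * G
    ≡⟨ regroup (length F) (length S) (a (node gs)) g X G ⟩
  length F * prefixSuffixSum⁺ (node gs ∷ cs) + length S * product (gList (node gs ∷ cs)) ∎
  where
  Tc = treesOfShape (node gs)
  F′ = snocForests F Tc
  Q = forestsOfShape gs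
  g = product (aList gs)
  X = prefixSuffixSum⁺ cs
  G = product (gList cs)
  regroup : ∀ f s x y X G → f * x * X + (f * x + s * y) * G ≡ f * (x * (X + G)) + s * (y * G)
  regroup = solve 6 (λ f s x y X G → f :* x :* X :+ (f :* x :+ s :* y) :* G
                                      := f :* (x :* (X :+ G)) :+ s :* (y :* G)) refl
    where open +-*-Solver

treeOfShape⇔labelled : ∀ T t →
  TreeOfShape T t ⇔ (shape t ≡ T × labels t ↭ oneTo (psize T) × InT t)
treeOfShape⇔labelled T t = mk⇔ to (λ (sh , _ , it) → sh , it)
  where
  to : TreeOfShape T t → shape t ≡ T × labels t ↭ oneTo (psize T) × InT t
  to (refl , it) = refl , subst (λ n → labels t ↭ oneTo n) (sym (psize-shape t)) (InT-wellLabelled it) , it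

proposition2p1 : (T : PTree) →
    Σ (List LTree) (λ L →
      Unique L
      × ((t : LTree) → (t ∈ L) ⇔ ((shape t ≡ T) × (labels t ↭ oneTo (psize T)) × InT t))
      × (length L ≡ a T))
proposition2p1 T = treesOfShape T , unique , members , length-treesOfShape T
  where open Enumerates (Enumerates-⇔ (treeOfShape⇔labelled T) (treesOfShape-enumerates T))
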